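{- Let $\phi$ be an unsatisfiable CNF formula in variables $x_1,\ldots,x_N$ whose clauses are written as $C=(\ell_1\vee\ell_2\vee\ell_3)$. Then the CNF $\Psi(\bar u,\bar v)=\Phi_1(\bar u,\bar v)\wedge\Phi_2(\bar u)$ constructed from $\phi$ as in the context is unsatisfiable.
   Context: For a literal $\ell$, $\mathrm{var}(\ell)$ is its variable and $\mathrm{sg}(\ell)$ its sign; $v^{\mathrm{sg}(\ell)}$ denotes $v$ if $\ell$ is positive and $\neg v$ if $\ell$ is negative. Introduce variables $\bar v=(v_1,\ldots,v_N)$ and, for every clause $C$ of $\phi$ and every triple $(i,j,k)$ of distinct indices in $[N]$, a variable $u_{C,i,j,k}$; $\bar u$ is the tuple of these. $\Phi_1$ is the conjunction, over all $C=(\ell_1\vee\ell_2\vee\ell_3)$ and all distinct $i,j,k$, of $\neg u_{C,i,j,k}\vee v_i^{\mathrm{sg}(\ell_1)}\vee v_j^{\mathrm{sg}(\ell_2)}\vee v_k^{\mathrm{sg}(\ell_3)}$. Let $\pi_{C,i,j,k}=\{v_i\mapsto\mathrm{var}(\ell_1),v_j\mapsto\mathrm{var}(\ell_2),v_k\mapsto\mathrm{var}(\ell_3)\}$; two such partial maps are incompatible if their union is not a one-to-one partial map from $\bar v$ to $\{x_1,\dots,x_N\}$. $\Phi_2$ is the conjunction of: for every clause $C$, the clause $\bigvee_{i,j,k\text{ distinct}}u_{C,i,j,k}$ and, for all distinct triples $(i,j,k)\neq(i',j',k')$, the clause $\neg u_{C,i,j,k}\vee\neg u_{C,i',j',k'}$;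 and for all clauses $C,D$ and triples $(i,j,k),(a,b,c)$ of distinct indices with $\pi_{C,i,j,k}$ and $\pi_{D,a,b,c}$ incompatible, the clause $\neg u_{C,i,j,k}\vee\neg u_{D,a,b,c}$. -}

module Defs where

open import Data.Nat using (ℕ)
open import Data.Fin using (Fin)
open import Data.Bool using (Bool; true; false; not; _∨_; if_then_else_)
open import Data.Product using (_×_; _,_; proj₁; proj₂; ∃)
open import Data.List using (List; []; _∷_; _++_)
open import Data.List.Membership.Propositional using (_∈_)
open import Relation.Binary.PropositionalEquality using (_≡_; _≢_)
open import Relation.Nullary using (¬_)

-- A literal over variables x_1..x_N: (variable, sign); sign true = positive.
Lit : ℕ → Set
Lit N = Fin N × Bool

var : ∀ {N} → Lit N → Fin N
var = proj₁

sg : ∀ {N} → Lit N → Bool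
sg = proj₂

Clause3 : ℕ → Set
Clause3 N = Lit N × Lit N × Lit N

CNF3 : ℕ → ℕ → Set
CNF3 N m = Fin m → Clause3 N

litVal : ∀ {N} → (Fin N → Bool) → Fin N → Bool → Bool
litVal α y s = if s then α y else not (α y)

evalLit : ∀ {N} → (Fin N → Bool) → Lit N → Bool
evalLit α ℓ = litVal α (var ℓ) (sg ℓ)

Satisfies : ∀ {N m} → CNF3 N m → (Fin N → Bool) → Set
Satisfies φ α = ∀ C → let (ℓ₁ , ℓ₂ , ℓ₃) = φ C in
  (evalLit α ℓ₁ ∨ evalLit α ℓ₂ ∨ evalLit α ℓ₃) ≡ true

Unsatisfiable : ∀ {N m} → CNF3 N m → Set
Unsatisfiable {N} φ = (α : Fin N → Bool) → ¬ Satisfies φ α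

Triple : ℕ → Set
Triple N = Fin N × Fin N × Fin N

Distinct : ∀ {N} → Triple N → Set
Distinct (i , j , k) = i ≢ j × i ≢ k × j ≢ k

-- Assignments to the variables of Ψ:
--   v : Fin N → Bool           (v_1..v_N)
--   u : Fin m → Triple N → Bool (u_{C,i,j,k}; only distinct triples are used)
VAssign : ℕ → Set
VAssign N = Fin N → Bool

UAssign : ℕ → ℕ → Set
UAssign N m = Fin m → Triple N → Bool

Φ₁ : ∀ {N m} → CNF3 N m → VAssign N → UAssign N m → Set
Φ₁ φ v u = ∀ C t → Distinct t →
  let (ℓ₁ , ℓ₂ , ℓ₃) = φ C ; (i , j , k) = t in
  (not (u C t) ∨ litVal v i (sg ℓ₁) ∨ litVal v j (sg ℓ₂) ∨ litVal v k (sg ℓ₃)) ≡ true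

-- π_{C,i,j,k} as a finite list of pairs (v-index ↦ x-index)
π : ∀ {N m} → CNF3 N m → Fin m → Triple N → List (Fin N × Fin N)
π φ C (i , j , k) = let (ℓ₁ , ℓ₂ , ℓ₃) = φ C in
  (i , var ℓ₁) ∷ (j , var ℓ₂) ∷ (k , var ℓ₃) ∷ []

OneToOne : ∀ {N} → List (Fin N × Fin N) → Set
OneToOne R = ∀ p q → p ∈ R → q ∈ R →
  (proj₁ p ≡ proj₁ q → proj₂ p ≡ proj₂ q) × (proj₂ p ≡ proj₂ q → proj₁ p ≡ proj₁ q)

Incompatible : ∀ {N} → List (Fin N × Fin N) → List (Fin N × Fin N) → Set
Incompatible R S = ¬ OneToOne (R ++ S)

Φ₂ : ∀ {N m} → CNF3 N m → UAssign N m → Set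
Φ₂ φ u =
  (∀ C → ∃ λ t → Distinct t × u C t ≡ true)
  × (∀ C t t' → Distinct t → Distinct t' → t ≢ t' →
       (not (u C t) ∨ not (u C t')) ≡ true)
  × (∀ C D t t' → Distinct t → Distinct t' → Incompatible (π φ C t) (π φ D t') →
       (not (u C t) ∨ not (u D t')) ≡ true)

Ψ-Satisfies : ∀ {N m} → CNF3 N m → VAssign N → UAssign N m → Set
Ψ-Satisfies φ v u = Φ₁ φ v u × Φ₂ φ u

Ψ-Unsatisfiable : ∀ {N m} → CNF3 N m → Set
Ψ-Unsatisfiable {N} {m} φ = (v : VAssign N) (u : UAssign N m) → ¬ Ψ-Satisfies φ v u

{-# OPTIONS --safe #-}
module Submission where

-- Let Ψ be satisfied by (v, u). The first clause of Φ₂ picks, for every clause C of φ, a triple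
-- t_C with u_{C,t_C} true, and the compatibility clauses force the maps π_{C,t_C} to be pairwise
-- compatible; in particular their union sends no two v-indices to the same x-variable. Hence
-- α(x) := v_i for any pair (i ↦ x) of that union is well defined, and along π_{C,t_C} the literals
-- of C evaluate under α exactly as the literals of the Φ₁-clause of (C, t_C) evaluate under v.
-- That Φ₁-clause is satisfied with u_{C,t_C} true, so α satisfies every clause of φ.

open import Data.Nat using (ℕ)
open import Data.Fin using (Fin)
open import Data.Fin.Properties using (_≟_)
open import Data.Bool using (Bool; true; false; not; _∨_)
open import Data.Product using (_×_; _,_; proj₁; proj₂)
open import Data.List using (List; []; _∷_; concatMap; allFin)
open import Data.List.Membership.Propositional using (_∈_; lose)
open import Data.List.Membership.Propositional.Properties
  using (∈-++⁺ˡ; ∈-++⁺ʳ; ∈-concatMap⁺; ∈-concatMap⁻; ∈-allFin)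
open import Data.List.Relation.Unary.Any using (here; there; satisfied)
open import Relation.Binary.Definitions using (DecidableEquality)
open import Relation.Binary.PropositionalEquality
  using (_≡_; refl; cong; cong₂; subst₂; module ≡-Reasoning)
open import Relation.Nullary using (¬_; yes; no; contradiction)
open import Relation.Nullary.Decidable using (decidable-stable)
open import Defs

LeftUnique : {A B : Set} → List (A × B) → Set
LeftUnique R = ∀ {p q} → p ∈ R → q ∈ R → proj₂ p ≡ proj₂ q → proj₁ p ≡ proj₁ q

module _ {A B X : Set} (_≟ᴮ_ : DecidableEquality B) (f : A → X) (x₀ : X) where

  pushforward : List (A × B) → B → X
  pushforward []             b = x₀
  pushforward ((a , b′) ∷ R) b with b′ ≟ᴮ b
  ... | yes _ = f a
  ... | no  _ = pushforward R b

  pushforward-∈ : ∀ {R p} → LeftUnique R → p ∈ R → pushforward R (proj₂ p) ≡ f (proj₁ p)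
  pushforward-∈ {(a , b) ∷ R} unique (here refl) with b ≟ᴮ b
  ... | yes _    = refl
  ... | no  b≢b  = contradiction refl b≢b
  pushforward-∈ {(a , b′) ∷ R} {p} unique (there p∈R) with b′ ≟ᴮ proj₂ p
  ... | yes b′≡b = cong f (unique (here refl) (there p∈R) b′≡b)
  ... | no  _    = pushforward-∈ (λ p∈ q∈ → unique (there p∈) (there q∈)) p∈R

-- Incompatible is a negation, so compatibility only yields a double negation; it is
-- removed pointwise because equality of indices is decidable.
compatible⇒leftUnique : ∀ {N} {R S : List (Fin N × Fin N)} → ¬ Incompatible R S →
                        ∀ {p q} → p ∈ R → q ∈ S → proj₂ p ≡ proj₂ q → proj₁ p ≡ proj₁ q
compatible⇒leftUnique {R = R} compatible {p} {q} p∈R q∈S p₂≡q₂ =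
  decidable-stable (proj₁ p ≟ proj₁ q) λ p₁≢q₁ → compatible λ oneToOne →
    p₁≢q₁ (proj₂ (oneToOne p q (∈-++⁺ˡ p∈R) (∈-++⁺ʳ R q∈S)) p₂≡q₂)

pairwiseCompatible⇒leftUnique : ∀ {N m} (R : Fin m → List (Fin N × Fin N)) →
                                (∀ C D → ¬ Incompatible (R C) (R D)) →
                                LeftUnique (concatMap R (allFin m))
pairwiseCompatible⇒leftUnique {m = m} R compatible p∈ q∈
  with satisfied (∈-concatMap⁻ R {allFin m} p∈) | satisfied (∈-concatMap⁻ R {allFin m} q∈)
... | C , p∈RC | D , q∈RD = compatible⇒leftUnique (compatible C D) p∈RC q∈RD

litVal-cong : ∀ {N} {α β : Fin N → Bool} {x y} s → α x ≡ β y → litVal α x s ≡ litVal β y s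
litVal-cong true  αx≡βy = αx≡βy
litVal-cong false αx≡βy = cong not αx≡βy

Φ₁⇒clause : ∀ {N m} (φ : CNF3 N m) {v u α} C t → Distinct t → Φ₁ φ v u → u C t ≡ true →
            (∀ {p} → p ∈ π φ C t → α (proj₂ p) ≡ v (proj₁ p)) →
            (evalLit α (proj₁ (φ C)) ∨ evalLit α (proj₁ (proj₂ (φ C)))
                                     ∨ evalLit α (proj₂ (proj₂ (φ C)))) ≡ true
Φ₁⇒clause φ {v} {u} {α} C t@(i , j , k) distinct φ₁ uCt agree = begin
  evalLit α ℓ₁ ∨ evalLit α ℓ₂ ∨ evalLit α ℓ₃
    ≡⟨ cong₂ _∨_ (agreeOn (sg ℓ₁) (here refl))
                 (cong₂ _∨_ (agreeOn (sg ℓ₂) (there (here refl)))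
                            (agreeOn (sg ℓ₃) (there (there (here refl))))) ⟩
  litVal v i (sg ℓ₁) ∨ litVal v j (sg ℓ₂) ∨ litVal v k (sg ℓ₃)
    ≡⟨ cong (λ b → not b ∨ litVal v i (sg ℓ₁) ∨ litVal v j (sg ℓ₂) ∨ litVal v k (sg ℓ₃)) uCt ⟨
  not (u C t) ∨ litVal v i (sg ℓ₁) ∨ litVal v j (sg ℓ₂) ∨ litVal v k (sg ℓ₃)
    ≡⟨ φ₁ C t distinct ⟩
  true ∎
  where
  open ≡-Reasoning
  agreeOn : ∀ {p} s → p ∈ π φ C t → litVal α (proj₂ p) s ≡ litVal v (proj₁ p) s
  agreeOn {p} s p∈ = litVal-cong {α = α} {v} {proj₂ p} {proj₁ p} s (agree p∈)
  ℓ₁ = proj₁ (φ C)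
  ℓ₂ = proj₁ (proj₂ (φ C))
  ℓ₃ = proj₂ (proj₂ (φ C))

proposition4p3 : ∀ {N m : ℕ} (φ : CNF3 N m) → Unsatisfiable φ → Ψ-Unsatisfiable φ
proposition4p3 {N} {m} φ unsat v u (φ₁ , chosen , _ , excluded) =
  unsat α λ C → Φ₁⇒clause φ {v} {u} C (t C) (distinct C) φ₁ (u-true C) λ p∈ →
    pushforward-∈ _≟_ v false unique (∈-concatMap⁺ R {allFin m} (lose (∈-allFin C) p∈))
  where
  t : Fin m → Triple N
  t C = proj₁ (chosen C)

  distinct : ∀ C → Distinct (t C)
  distinct C = proj₁ (proj₂ (chosen C))

  u-true : ∀ C → u C (t C) ≡ true
  u-true C = proj₂ (proj₂ (chosen C))

  R : Fin m → List (Fin N × Fin N)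
  R C = π φ C (t C)

  compatible : ∀ C D → ¬ Incompatible (R C) (R D)
  compatible C D incompatible
    with subst₂ (λ a b → (not a ∨ not b) ≡ true) (u-true C) (u-true D)
                (excluded C D (t C) (t D) (distinct C) (distinct D) incompatible)
  ... | ()

  unique : LeftUnique (concatMap R (allFin m))
  unique = pairwiseCompatible⇒leftUnique R compatible

  α : Fin N → Bool
  α = pushforward _≟_ v false (concatMap R (allFin m))
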